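{- Let $G$ be a (banner, $C_5$)-free graph containing an odd antihole $A$, and suppose some two vertices of $A$ belong to a co-triangle of $G$. Then there is a homogeneous set $H$ of $G$ such that $A \subseteq H$ and no co-triangle of $G[H]$ contains two vertices of $A$.
   Context: All graphs are finite and simple. A hole is an induced cycle $C_k$ with $k\ge 4$, odd if $k$ is odd; an odd antihole is the complement of an odd hole. A banner is an induced $C_4$ plus one vertex adjacent to exactly one vertex of the $C_4$. $G$ is $L$-free if it has no induced subgraph isomorphic to a member of $L$. A co-triangle is a stable set of three vertices. A set $H \subseteq V(G)$ is homogeneous if $2 \leq |H| < |V(G)|$ and every vertex outside $H$ is adjacent to all or to none of the vertices of $H$. $G[H]$ is the induced subgraph on $H$. -}

module Defs where

open import Data.Nat using (ℕ; zero; suc; _≤_; _<_; _≡ᵇ_; _*_)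

open import Data.Bool using (Bool; true; false; _∨_; _∧_; not)
open import Data.Fin using (Fin; toℕ; zero; suc)
open import Data.Fin.Subset using (Subset; _∈_; _∉_; ∣_∣)
open import Data.Product using (Σ; _×_; ∃-syntax)
open import Data.Sum using (_⊎_)
open import Function.Definitions using (Injective)
open import Relation.Binary.PropositionalEquality using (_≡_; _≢_)
open import Relation.Nullary using (¬_)

record Graph (n : ℕ) : Set where
  field
    adj    : Fin n → Fin n → Bool
    sym    : ∀ i j → adj i j ≡ adj j i
    irrefl : ∀ i → adj i i ≡ false
open Graph public

Adj : ∀ {n} → Graph n → Fin n → Fin n → Set
Adj G x y = adj G x y ≡ true

NonAdj : ∀ {n} → Graph n → Fin n → Fin n → Set
NonAdj G x y = adj G x y ≡ false

cycAdj : (k : ℕ) → Fin k → Fin k → Bool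
cycAdj k i j =
  (toℕ j ≡ᵇ suc (toℕ i)) ∨ (toℕ i ≡ᵇ suc (toℕ j))
  ∨ ((toℕ i ≡ᵇ 0) ∧ (suc (toℕ j) ≡ᵇ k))
  ∨ ((toℕ j ≡ᵇ 0) ∧ (suc (toℕ i) ≡ᵇ k))

antiCycAdj : (k : ℕ) → Fin k → Fin k → Bool
antiCycAdj k i j = not (cycAdj k i j) ∧ not (toℕ i ≡ᵇ toℕ j)

bannerAdj : Fin 5 → Fin 5 → Bool
bannerAdj i j = e (toℕ i) (toℕ j) ∨ e (toℕ j) (toℕ i)
  where
  e : ℕ → ℕ → Bool
  e 0 1 = true
  e 1 2 = true
  e 2 3 = true
  e 3 0 = true
  e 4 0 = true
  e _ _ = false

Induces : ∀ {n k} → Graph n → (Fin k → Fin n) → (Fin k → Fin k → Bool) → Set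
Induces G f h = Injective _≡_ _≡_ f × (∀ i j → adj G (f i) (f j) ≡ h i j)

ContainsInduced : ∀ {n} → Graph n → (k : ℕ) → (Fin k → Fin k → Bool) → Set
ContainsInduced {n} G k h = Σ (Fin k → Fin n) λ f → Induces G f h

BannerFree : ∀ {n} → Graph n → Set
BannerFree G = ¬ ContainsInduced G 5 bannerAdj

C5Free : ∀ {n} → Graph n → Set
C5Free G = ¬ ContainsInduced G 5 (cycAdj 5)

Odd : ℕ → Set
Odd m = ∃[ k ] m ≡ suc (2 * k)

IsOddAntihole : ∀ {n m} → Graph n → (Fin m → Fin n) → Set
IsOddAntihole {m = m} G f = Odd m × 5 ≤ m × Induces G f (antiCycAdj m)

CoTriangle : ∀ {n} → Graph n → Fin n → Fin n → Fin n → Set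
CoTriangle G x y z =
  x ≢ y × x ≢ z × y ≢ z × NonAdj G x y × NonAdj G x z × NonAdj G y z

Homogeneous : ∀ {n} → Graph n → Subset n → Set
Homogeneous {n} G H =
  2 ≤ ∣ H ∣ × ∣ H ∣ < n ×
  (∀ v → v ∉ H → (∀ h → h ∈ H → Adj G v h) ⊎ (∀ h → h ∈ H → NonAdj G v h))

module Submission where

-- Let A = a₀ … a_{M-1} be an odd antihole (M = 2K + 1) in a (banner, C₅)-free
-- graph G; indices are read cyclically, so aₚ and aₚ₊₁ are the only
-- non-adjacent pairs of A.  Let Z be the set of vertices anticomplete to A
-- and H the set of vertices that are neither in Z nor adjacent to Z.
--
--  * Banner-freeness propagates non-adjacency around A: a vertex outside A
--    missing two consecutive aₚ, aₚ₊₁ misses all of A.  So the third vertex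
--    of a co-triangle through two vertices of A lies in Z.
--  * Since M is odd, a vertex outside A with a neighbour in A has two
--    consecutive neighbours in A.
--  * If v has a neighbour in Z and two consecutive neighbours in A, then
--    freeness of C₅ and banners makes v complete to A, and then to H.
--
-- Hence H is homogeneous and contains A; it is a proper subset since the
-- third vertex of the given co-triangle lies in Z, and no co-triangle
-- through two vertices of A meets H.

open import Defs hiding (sym)
open import Data.Bool using (Bool; true; false; not; _∧_; _∨_)
import Data.Bool as Bool
open import Data.Bool.Properties using (¬-not; not-involutive; T-≡)
open import Data.Nat using (ℕ; zero; suc; z<s; _+_; _*_; _∸_; _≤_; _<_; _≡ᵇ_; NonZero; _<?_; z≤n; s≤s)
open import Data.Nat.Properties hiding (_≟_)
open import Data.Nat.DivMod
  using (_%_; %-distribˡ-+; m%n%n≡m%n; m%n<n; m<n⇒m%n≡m; m≤n⇒[n∸m]%m≡n%m; n%n≡0;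
         [m+n]%n≡m%n; [m+kn]%n≡m%n)
open import Data.Fin using (Fin; zero; suc; toℕ; fromℕ<; _≟_)
open import Data.Fin.Properties using (all?; any?; ¬∀⟶∃¬; toℕ-injective; toℕ<n; toℕ-fromℕ<; fromℕ<-cong)
open import Data.Fin.Subset using (Subset; _∈_; _∉_; ∣_∣; ⁅_⁆)
open import Data.Fin.Subset.Properties using (∈⊤; x∈⁅y⁆⇒x≡y; ∣⁅x⁆∣≡1; ∣⊤∣≡n; p⊂q⇒∣p∣<∣q∣)
open import Data.Vec using (tabulate)
open import Data.Vec.Properties using (lookup∘tabulate; []=⇒lookup; lookup⇒[]=)
open import Data.Product using (_×_; _,_; proj₁; proj₂; ∃-syntax)
import Data.Product.Properties as Product
open import Data.Sum using (_⊎_; inj₁; inj₂)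
open import Data.Empty using (⊥; ⊥-elim)
open import Relation.Binary.PropositionalEquality
open import Function using (_∘_; Equivalence)
open import Relation.Nullary using (¬_; Dec; yes; no; does)
open import Relation.Nullary.Decidable using (toWitness; dec-true; map′; ¬?; _×-dec_; _→-dec_; _⊎-dec_)

pattern v₀ = zero
pattern v₁ = suc zero
pattern v₂ = suc (suc zero)
pattern v₃ = suc (suc (suc zero))
pattern v₄ = suc (suc (suc (suc zero)))

true≢false : true ≢ false
true≢false ()

∨-true : ∀ a {b} → a ∨ b ≡ true → a ≡ true ⊎ b ≡ true
∨-true true  _ = inj₁ refl
∨-true false e = inj₂ e

∨-trueˡ : ∀ {a b} → a ≡ true → a ∨ b ≡ true
∨-trueˡ refl = refl

∨-trueʳ : ∀ a {b} → b ≡ true → a ∨ b ≡ true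
∨-trueʳ true  _ = refl
∨-trueʳ false e = e

∧-true : ∀ a {b} → a ∧ b ≡ true → a ≡ true × b ≡ true
∧-true true e = refl , e

∧-intro : ∀ {a b} → a ≡ true → b ≡ true → a ∧ b ≡ true
∧-intro refl e = e

≡ᵇ-true : ∀ x y → (x ≡ᵇ y) ≡ true → x ≡ y
≡ᵇ-true x y e = ≡ᵇ⇒≡ x y (Equivalence.from T-≡ e)

≡ᵇ-intro : ∀ {x y} → x ≡ y → (x ≡ᵇ y) ≡ true
≡ᵇ-intro {x} {y} e = Equivalence.to T-≡ (≡⇒≡ᵇ x y e)

Twins : ∀ {k} → (Fin k → Fin k → Bool) → Fin k → Fin k → Set
Twins h i j = ∀ l → h l i ≡ h l j

twins? : ∀ {k} (h : Fin k → Fin k → Bool) i j → Dec (Twins h i j)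
twins? h i j = all? λ l → h l i Bool.≟ h l j

c5-twin-free : ∀ i j → Twins (cycAdj 5) i j → i ≡ j
c5-twin-free = toWitness {a? = all? λ i → all? λ j → twins? (cycAdj 5) i j →-dec i ≟ j} _

banner-twins : ∀ i j → Twins bannerAdj i j → i ≡ j ⊎ (i , j) ≡ (v₁ , v₃) ⊎ (i , j) ≡ (v₃ , v₁)
banner-twins = toWitness {a? = all? λ i → all? λ j → twins? bannerAdj i j →-dec
  (i ≟ j ⊎-dec Product.≡-dec _≟_ _≟_ (i , j) _ ⊎-dec Product.≡-dec _≟_ _≟_ (i , j) _)} _

module GraphFacts {n : ℕ} (G : Graph n) where

  adj-sym : ∀ {x y b} → adj G x y ≡ b → adj G y x ≡ b
  adj-sym {x} {y} e = trans (Graph.sym G y x) e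

  separated : ∀ {w x y} → Adj G w x → NonAdj G w y → x ≢ y
  separated e e' refl with trans (sym e) e'
  ... | ()

  -- A labelling realising the adjacency pattern h can only merge twins of h,
  -- so if it keeps twins apart it is an induced copy of h.
  realise : ∀ {k} {h : Fin k → Fin k → Bool} (f : Fin k → Fin n) →
    (∀ i j → adj G (f i) (f j) ≡ h i j) →
    (∀ {i j} → Twins h i j → f i ≡ f j → i ≡ j) → ContainsInduced G k h
  realise {h = h} f table keep = f , (λ e → keep (twins e) e) , table
    where
    twins : ∀ {i j} → f i ≡ f j → Twins h i j
    twins {i} {j} e l = trans (sym (table l i)) (trans (cong (adj G (f l)) e) (table l j))

  noBanner : BannerFree G → (c₀ c₁ c₂ c₃ p : Fin n) →
    Adj G c₀ c₁ → Adj G c₁ c₂ → Adj G c₂ c₃ → Adj G c₃ c₀ →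
    NonAdj G c₀ c₂ → NonAdj G c₁ c₃ →
    Adj G p c₀ → NonAdj G p c₁ → NonAdj G p c₂ → NonAdj G p c₃ → c₁ ≢ c₃ → ⊥
  noBanner free c₀ c₁ c₂ c₃ p e01 e12 e23 e30 e02 e13 ep0 ep1 ep2 ep3 c₁≢c₃ =
    free (realise f table keep)
    where
    f : Fin 5 → Fin n
    f v₀ = c₀
    f v₁ = c₁
    f v₂ = c₂
    f v₃ = c₃
    f v₄ = p
    table : ∀ i j → adj G (f i) (f j) ≡ bannerAdj i j
    table v₀ v₀ = Graph.irrefl G c₀
    table v₀ v₁ = e01
    table v₀ v₂ = e02
    table v₀ v₃ = adj-sym e30
    table v₀ v₄ = adj-sym ep0
    table v₁ v₀ = adj-sym e01
    table v₁ v₁ = Graph.irrefl G c₁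
    table v₁ v₂ = e12
    table v₁ v₃ = e13
    table v₁ v₄ = adj-sym ep1
    table v₂ v₀ = adj-sym e02
    table v₂ v₁ = adj-sym e12
    table v₂ v₂ = Graph.irrefl G c₂
    table v₂ v₃ = e23
    table v₂ v₄ = adj-sym ep2
    table v₃ v₀ = e30
    table v₃ v₁ = adj-sym e13
    table v₃ v₂ = adj-sym e23
    table v₃ v₃ = Graph.irrefl G c₃
    table v₃ v₄ = adj-sym ep3
    table v₄ v₀ = ep0
    table v₄ v₁ = ep1
    table v₄ v₂ = ep2
    table v₄ v₃ = ep3
    table v₄ v₄ = Graph.irrefl G p
    keep : ∀ {i j} → Twins bannerAdj i j → f i ≡ f j → i ≡ j
    keep {i} {j} t e with banner-twins i j t
    ... | inj₁ i≡j = i≡j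
    ... | inj₂ (inj₁ refl) = ⊥-elim (c₁≢c₃ e)
    ... | inj₂ (inj₂ refl) = ⊥-elim (c₁≢c₃ (sym e))

  noC5 : C5Free G → (c₀ c₁ c₂ c₃ c₄ : Fin n) →
    Adj G c₀ c₁ → Adj G c₁ c₂ → Adj G c₂ c₃ → Adj G c₃ c₄ → Adj G c₄ c₀ →
    NonAdj G c₀ c₂ → NonAdj G c₀ c₃ → NonAdj G c₁ c₃ → NonAdj G c₁ c₄ → NonAdj G c₂ c₄ → ⊥
  noC5 free c₀ c₁ c₂ c₃ c₄ e01 e12 e23 e34 e40 e02 e03 e13 e14 e24 =
    free (realise f table (λ t _ → c5-twin-free _ _ t))
    where
    f : Fin 5 → Fin n
    f v₀ = c₀
    f v₁ = c₁
    f v₂ = c₂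
    f v₃ = c₃
    f v₄ = c₄
    table : ∀ i j → adj G (f i) (f j) ≡ cycAdj 5 i j
    table v₀ v₀ = Graph.irrefl G c₀
    table v₀ v₁ = e01
    table v₀ v₂ = e02
    table v₀ v₃ = e03
    table v₀ v₄ = adj-sym e40
    table v₁ v₀ = adj-sym e01
    table v₁ v₁ = Graph.irrefl G c₁
    table v₁ v₂ = e12
    table v₁ v₃ = e13
    table v₁ v₄ = e14
    table v₂ v₀ = adj-sym e02
    table v₂ v₁ = adj-sym e12
    table v₂ v₂ = Graph.irrefl G c₂
    table v₂ v₃ = e23
    table v₂ v₄ = e24
    table v₃ v₀ = adj-sym e03
    table v₃ v₁ = adj-sym e13
    table v₃ v₂ = adj-sym e23
    table v₃ v₃ = Graph.irrefl G c₃
    table v₃ v₄ = e34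
    table v₄ v₀ = e40
    table v₄ v₁ = adj-sym e14
    table v₄ v₂ = adj-sym e24
    table v₄ v₃ = adj-sym e34
    table v₄ v₄ = Graph.irrefl G c₄

%-absorbʳ : ∀ a t M .{{_ : NonZero M}} → (a + t % M) % M ≡ (a + t) % M
%-absorbʳ a t M = begin
  (a + t % M) % M          ≡⟨ %-distribˡ-+ a (t % M) M ⟩
  (a % M + t % M % M) % M  ≡⟨ cong (λ u → (a % M + u) % M) (m%n%n≡m%n t M) ⟩
  (a % M + t % M) % M      ≡⟨ %-distribˡ-+ a t M ⟨
  (a + t) % M              ∎
  where open ≡-Reasoning

-- A residue r < M is moved by every shift c with 0 < c < M: the shifted
-- residue is either c + r > r, or it wraps around to c + r ∸ M < r.
shift-moves-residue : ∀ {c r M} .{{_ : NonZero M}} → 0 < c → c < M → r < M → (c + r) % M ≢ r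
shift-moves-residue {c} {r} {M} 0<c c<M r<M eq with c + r <? M
... | yes c+r<M = <⇒≢ (m<n+m r 0<c) (sym (trans (sym (m<n⇒m%n≡m c+r<M)) eq))
... | no c+r≮M = <⇒≢ wrapped<r (trans (sym wrapped) eq)
  where
  M≤c+r : M ≤ c + r
  M≤c+r = ≮⇒≥ c+r≮M
  wrapped<r : c + r ∸ M < r
  wrapped<r = subst (c + r ∸ M <_) (m+n∸m≡n M r) (∸-monoˡ-< (+-monoˡ-< r c<M) M≤c+r)
  wrapped : (c + r) % M ≡ c + r ∸ M
  wrapped = trans (sym (m≤n⇒[n∸m]%m≡n%m M≤c+r)) (m<n⇒m%n≡m (<-trans wrapped<r r<M))

shift-apart : ∀ {a b} t M .{{_ : NonZero M}} → a < b → b < M → (b + t) % M ≢ (a + t) % M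
shift-apart {a} {b} t M a<b b<M eq =
  shift-moves-residue (m<n⇒0<n∸m a<b) (≤-<-trans (m∸n≤m b a) b<M) (m%n<n (a + t) M)
    (trans (%-absorbʳ (b ∸ a) (a + t) M) (trans (cong (_% M) regroup) eq))
  where
  regroup : b ∸ a + (a + t) ≡ b + t
  regroup = trans (sym (+-assoc (b ∸ a) a t)) (cong (_+ t) (m∸n+n≡m (<⇒≤ a<b)))

-- Parity: a Boolean sequence with f (2K + 1) = f 0 takes the same value at
-- two consecutive positions (an odd cycle cannot be properly 2-coloured).
odd-repeat : ∀ K (f : ℕ → Bool) → f (suc (2 * K)) ≡ f 0 → ∃[ q ] f (suc q) ≡ f q
odd-repeat K f periodic with alternating K
  where
  alternating : ∀ k → (∃[ q ] f (suc q) ≡ f q) ⊎ f (2 * k) ≡ f 0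
  alternating zero = inj₂ refl
  alternating (suc k) with alternating k | f (suc (2 * k)) Bool.≟ f (2 * k) | f (2 + 2 * k) Bool.≟ f (suc (2 * k))
  ... | inj₁ repeat | _ | _ = inj₁ repeat
  ... | inj₂ _ | yes same | _ = inj₁ (2 * k , same)
  ... | inj₂ _ | no _ | yes same = inj₁ (suc (2 * k) , same)
  ... | inj₂ even | no flip₁ | no flip₂ = inj₂ (begin
    f (2 * suc k)           ≡⟨ cong f (*-suc 2 k) ⟩
    f (2 + 2 * k)           ≡⟨ ¬-not flip₂ ⟩
    not (f (suc (2 * k)))   ≡⟨ cong not (¬-not flip₁) ⟩
    not (not (f (2 * k)))   ≡⟨ not-involutive (f (2 * k)) ⟩
    f (2 * k)               ≡⟨ even ⟩
    f 0                     ∎)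
    where open ≡-Reasoning
... | inj₁ repeat = repeat
... | inj₂ even = 2 * K , trans periodic (sym even)

CyclicSucc : ∀ {m} → Fin (suc m) → Fin (suc m) → Set
CyclicSucc {m} i j = suc (toℕ i) % suc m ≡ toℕ j

succ-below : ∀ {x y M} .{{_ : NonZero M}} → y ≡ suc x → y < M → suc x % M ≡ y
succ-below refl y<M = m<n⇒m%n≡m y<M

succ-wrap : ∀ {x M} .{{_ : NonZero M}} → suc x ≡ M → suc x % M ≡ 0
succ-wrap {M = M} refl = n%n≡0 M

cycAdj⇒succ : ∀ {m} (i j : Fin (suc m)) → cycAdj (suc m) i j ≡ true → CyclicSucc i j ⊎ CyclicSucc j i
cycAdj⇒succ {m} i j adjacent with ∨-true (toℕ j ≡ᵇ suc (toℕ i)) adjacent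
... | inj₁ j-next = inj₁ (succ-below (≡ᵇ-true (toℕ j) (suc (toℕ i)) j-next) (toℕ<n j))
... | inj₂ rest with ∨-true (toℕ i ≡ᵇ suc (toℕ j)) rest
... | inj₁ i-next = inj₂ (succ-below (≡ᵇ-true (toℕ i) (suc (toℕ j)) i-next) (toℕ<n i))
... | inj₂ rest′ with ∨-true ((toℕ i ≡ᵇ 0) ∧ (toℕ j ≡ᵇ m)) rest′
... | inj₁ i-wraps = let (i≡0 , j-last) = ∧-true (toℕ i ≡ᵇ 0) i-wraps in
  inj₂ (trans (succ-wrap (cong suc (≡ᵇ-true (toℕ j) m j-last))) (sym (≡ᵇ-true (toℕ i) 0 i≡0)))
... | inj₂ j-wraps = let (j≡0 , i-last) = ∧-true (toℕ j ≡ᵇ 0) j-wraps in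
  inj₁ (trans (succ-wrap (cong suc (≡ᵇ-true (toℕ i) m i-last))) (sym (≡ᵇ-true (toℕ j) 0 j≡0)))

succ⇒cycAdj : ∀ {m} (i j : Fin (suc m)) → CyclicSucc i j → cycAdj (suc m) i j ≡ true
succ⇒cycAdj {m} i j succ with suc (toℕ i) <? suc m
... | yes below = ∨-trueˡ (≡ᵇ-intro (sym (trans (sym (m<n⇒m%n≡m below)) succ)))
... | no ¬below =
  ∨-trueʳ (toℕ j ≡ᵇ suc (toℕ i)) (∨-trueʳ (toℕ i ≡ᵇ suc (toℕ j))
    (∨-trueʳ ((toℕ i ≡ᵇ 0) ∧ (suc (toℕ j) ≡ᵇ suc m)) (∧-intro (≡ᵇ-intro j≡0) (≡ᵇ-intro last))))
  where
  last : suc (toℕ i) ≡ suc m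
  last = ≤-antisym (toℕ<n i) (≮⇒≥ ¬below)
  j≡0 : toℕ j ≡ 0
  j≡0 = trans (sym succ) (succ-wrap last)

antiCycAdj-cyc : ∀ {k} (i j : Fin k) → cycAdj k i j ≡ true → antiCycAdj k i j ≡ false
antiCycAdj-cyc i j e = cong (λ b → not b ∧ not (toℕ i ≡ᵇ toℕ j)) e

antiCycAdj-far : ∀ {k} (i j : Fin k) → cycAdj k i j ≡ false → (toℕ i ≡ᵇ toℕ j) ≡ false →
  antiCycAdj k i j ≡ true
antiCycAdj-far i j e e′ = cong₂ (λ b c → not b ∧ not c) e e′

antiCycAdj⇒cyc : ∀ {k} (i j : Fin k) → antiCycAdj k i j ≡ false → toℕ i ≢ toℕ j → cycAdj k i j ≡ true
antiCycAdj⇒cyc i j e i≢j =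
  ¬-not λ c → true≢false (trans (sym (antiCycAdj-far i j c (¬-not (i≢j ∘ ≡ᵇ-true (toℕ i) (toℕ j))))) e)

-- An antihole A = a₀ … a_{M-1} of odd length M = 2K + 1, indexed cyclically
-- by all natural numbers: α q = a_{q mod M}.
module CyclicAntihole {n : ℕ} (G : Graph n) (K : ℕ) (A : Fin (suc (2 * K)) → Fin n)
  (antihole : ∀ i j → adj G (A i) (A j) ≡ antiCycAdj (suc (2 * K)) i j) where

  M : ℕ
  M = suc (2 * K)

  ι : ℕ → Fin M
  ι q = fromℕ< (m%n<n q M)

  α : ℕ → Fin n
  α q = A (ι q)

  toℕ-ι : ∀ q → toℕ (ι q) ≡ q % M
  toℕ-ι q = toℕ-fromℕ< (m%n<n q M)

  α-at : ∀ q i → q % M ≡ toℕ i → α q ≡ A i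
  α-at q i e = cong A (toℕ-injective (trans (toℕ-ι q) e))

  α-cong : ∀ q r → q % M ≡ r % M → α q ≡ α r
  α-cong q r e = cong A (fromℕ<-cong _ _ e (m%n<n q M) (m%n<n r M))

  α-toℕ : ∀ i → α (toℕ i) ≡ A i
  α-toℕ i = α-at (toℕ i) i (m<n⇒m%n≡m (toℕ<n i))

  α-period : ∀ q → α (q + M) ≡ α q
  α-period q = α-cong (q + M) q ([m+n]%n≡m%n q M)

  α-reach : ∀ p r → ∃[ d ] α r ≡ α (d + p)
  α-reach p r = r + p * (2 * K) ,
    α-cong r (r + p * (2 * K) + p) (sym (trans (cong (_% M) laps) ([m+kn]%n≡m%n r p M)))
    where
    laps : r + p * (2 * K) + p ≡ r + p * M
    laps = trans (+-assoc r _ p) (cong (r +_) (trans (+-comm (p * (2 * K)) p) (sym (*-suc p (2 * K)))))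

  -- Position 2K + q is the predecessor of q.
  α-prev : ∀ s q → α (suc s + (2 * K + q)) ≡ α (s + q)
  α-prev s q = trans (cong α shifted) (α-period (s + q))
    where
    shifted : suc s + (2 * K + q) ≡ s + q + M
    shifted = begin
      suc (s + (2 * K + q)) ≡⟨ cong (λ t → suc (s + t)) (+-comm (2 * K) q) ⟩
      suc (s + (q + 2 * K)) ≡⟨ cong suc (+-assoc s q (2 * K)) ⟨
      suc (s + q + 2 * K)   ≡⟨ +-suc (s + q) (2 * K) ⟨
      s + q + M             ∎
      where open ≡-Reasoning

  succ-ι : ∀ q → suc (toℕ (ι q)) % M ≡ suc q % M
  succ-ι q = trans (cong (λ t → suc t % M) (toℕ-ι q)) (%-absorbʳ 1 q M)

  gap : ∀ q → NonAdj G (α q) (α (suc q))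
  gap q = trans (antihole (ι q) (ι (suc q)))
    (antiCycAdj-cyc (ι q) (ι (suc q))
      (succ⇒cycAdj (ι q) (ι (suc q)) (trans (succ-ι q) (sym (toℕ-ι (suc q))))))

  far : ∀ d q → 2 ≤ d → suc d < M → Adj G (α q) (α (d + q))
  far d q 2≤d d+1<M = trans (antihole (ι q) (ι (d + q)))
    (antiCycAdj-far (ι q) (ι (d + q)) (¬-not not-successive) (¬-not (distinct ∘ ≡ᵇ-true _ _)))
    where
    d<M : d < M
    d<M = <-trans (n<1+n d) d+1<M
    distinct : toℕ (ι q) ≢ toℕ (ι (d + q))
    distinct e = shift-apart {a = 0} q M (<-trans z<s 2≤d) d<M
      (sym (trans (sym (toℕ-ι q)) (trans e (toℕ-ι (d + q)))))
    not-successive : cycAdj M (ι q) (ι (d + q)) ≢ true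
    not-successive adjacent with cycAdj⇒succ (ι q) (ι (d + q)) adjacent
    ... | inj₁ forward = shift-apart q M 2≤d d<M
      (sym (trans (sym (succ-ι q)) (trans forward (toℕ-ι (d + q)))))
    ... | inj₂ backward = shift-apart {a = 0} q M z<s d+1<M
      (trans (sym (succ-ι (d + q))) (trans backward (toℕ-ι q)))

  nonadjacent⇒consecutive : ∀ i j → A i ≢ A j → NonAdj G (A i) (A j) →
    ∃[ p ] ((A i ≡ α p × A j ≡ α (suc p)) ⊎ (A j ≡ α p × A i ≡ α (suc p)))
  nonadjacent⇒consecutive i j Ai≢Aj nonadj
    with cycAdj⇒succ i j
           (antiCycAdj⇒cyc i j (trans (sym (antihole i j)) nonadj) (Ai≢Aj ∘ cong A ∘ toℕ-injective))
  ... | inj₁ j-next = toℕ i , inj₁ (sym (α-toℕ i) , sym (α-at (suc (toℕ i)) j j-next))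
  ... | inj₂ i-next = toℕ j , inj₂ (sym (α-toℕ j) , sym (α-at (suc (toℕ j)) i i-next))

select : ∀ {n} {P : Fin n → Set} → (∀ x → Dec (P x)) → Subset n
select P? = tabulate (λ x → does (P? x))

select-∈ : ∀ {n} {P : Fin n → Set} (P? : ∀ x → Dec (P x)) {x} → P x → x ∈ select P?
select-∈ P? {x} px = lookup⇒[]= x _ (trans (lookup∘tabulate _ x) (dec-true (P? x) px))

select-∈⁻ : ∀ {n} {P : Fin n → Set} (P? : ∀ x → Dec (P x)) {x} → x ∈ select P? → P x
select-∈⁻ P? {x} x∈ with P? x | trans (sym (lookup∘tabulate _ x)) ([]=⇒lookup x∈)
... | yes px | _ = px
... | no _ | ()

two-members : ∀ {n} {p : Subset n} {x y} → x ∈ p → y ∈ p → x ≢ y → 2 ≤ ∣ p ∣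
two-members {p = p} {x} {y} x∈p y∈p x≢y =
  subst (_< ∣ p ∣) (∣⁅x⁆∣≡1 x) (p⊂q⇒∣p∣<∣q∣ (⁅x⁆⊆p , y , y∈p , x≢y ∘ sym ∘ x∈⁅y⁆⇒x≡y x))
  where
  ⁅x⁆⊆p : ∀ {z} → z ∈ ⁅ x ⁆ → z ∈ p
  ⁅x⁆⊆p z∈⁅x⁆ = subst (_∈ p) (sym (x∈⁅y⁆⇒x≡y x z∈⁅x⁆)) x∈p

missing-member : ∀ {n} {p : Subset n} {x} → x ∉ p → ∣ p ∣ < n
missing-member {n} {p} {x} x∉p = subst (∣ p ∣ <_) (∣⊤∣≡n n) (p⊂q⇒∣p∣<∣q∣ ((λ _ → ∈⊤) , x , ∈⊤ , x∉p))

¬→-elim : ∀ {P Q : Set} → Dec P → ¬ (P → Q) → P × ¬ Q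
¬→-elim (yes p) ¬[p→q] = p , λ q → ¬[p→q] (λ _ → q)
¬→-elim (no ¬p) ¬[p→q] = ⊥-elim (¬[p→q] (λ p → ⊥-elim (¬p p)))

SharesCoTriangle : ∀ {n m} → Graph n → (Fin m → Fin n) → Set
SharesCoTriangle G A = ∃[ i ] ∃[ j ] ∃[ z ] CoTriangle G (A i) (A j) z

HomogeneousCover : ∀ {n m} → Graph n → (Fin m → Fin n) → Set
HomogeneousCover G A = ∃[ H ] (Homogeneous G H × (∀ i → A i ∈ H) ×
  ¬ (∃[ i ] ∃[ j ] ∃[ z ] (z ∈ H × CoTriangle G (A i) (A j) z)))

module AroundOddAntihole {n : ℕ} (G : Graph n) (bannerFree : BannerFree G) (c5Free : C5Free G)
  (K : ℕ) (A : Fin (suc (2 * K)) → Fin n)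
  (antihole : ∀ i j → adj G (A i) (A j) ≡ antiCycAdj (suc (2 * K)) i j)
  (7≤M : 7 ≤ suc (2 * K)) where

  open GraphFacts G
  open CyclicAntihole G K A antihole

  -- Since M ≥ 7, every distance d ≤ 5 satisfies d ≤ M - 2, so the vertices
  -- at distance 2, 3, 4 and 5 along A are adjacent.
  room : ∀ {d} → d ≤ 5 → suc d < M
  room d≤5 = ≤-trans (s≤s (s≤s d≤5)) 7≤M

  far₂ : ∀ q → Adj G (α q) (α (2 + q))
  far₂ q = far 2 q (s≤s (s≤s z≤n)) (room (s≤s (s≤s z≤n)))

  far₃ : ∀ q → Adj G (α q) (α (3 + q))
  far₃ q = far 3 q (s≤s (s≤s z≤n)) (room (s≤s (s≤s (s≤s z≤n))))

  far₄ : ∀ q → Adj G (α q) (α (4 + q))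
  far₄ q = far 4 q (s≤s (s≤s z≤n)) (room (s≤s (s≤s (s≤s (s≤s z≤n)))))

  far₅ : ∀ q → Adj G (α q) (α (5 + q))
  far₅ q = far 5 q (s≤s (s≤s z≤n)) 7≤M

  consecutive-distinct : ∀ q → α q ≢ α (suc q)
  consecutive-distinct q = separated (adj-sym (far₂ q)) (adj-sym (gap (suc q)))

  prev-gap : ∀ q → NonAdj G (α (2 * K + q)) (α q)
  prev-gap q = subst (NonAdj G (α (2 * K + q))) (α-prev 0 q) (gap (2 * K + q))

  prev-far₂ : ∀ q → Adj G (α (2 * K + q)) (α (1 + q))
  prev-far₂ q = subst (Adj G (α (2 * K + q))) (α-prev 1 q) (far₂ (2 * K + q))

  prev-far₃ : ∀ q → Adj G (α (2 * K + q)) (α (2 + q))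
  prev-far₃ q = subst (Adj G (α (2 * K + q))) (α-prev 2 q) (far₃ (2 * K + q))

  around : (P : Fin n → Set) → (∀ q → P (α q) → P (α (suc q)) → P (α (2 + q))) →
    ∀ p → P (α p) → P (α (suc p)) → ∀ r → P (α r)
  around P step p P₀ P₁ r with α-reach p r
  ... | d , α-r = subst P (sym α-r) (proj₁ (pairs d))
    where
    pairs : ∀ d → P (α (d + p)) × P (α (suc d + p))
    pairs zero = P₀ , P₁
    pairs (suc d) = let (Pd , Pd+1) = pairs d in Pd+1 , step (d + p) Pd Pd+1

  Anticomplete : Fin n → Set
  Anticomplete x = ∀ q → NonAdj G x (α q)

  -- Banner-freeness: a vertex x ≢ α p missing α p and α (1 + p) also misses
  -- α (2 + p); otherwise one of four banners appears.
  miss-next : ∀ x p → x ≢ α p → NonAdj G x (α p) → NonAdj G x (α (1 + p)) → NonAdj G x (α (2 + p))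
  miss-next x p x≢αp h₀ h₁ with adj G x (α (2 + p)) in e₂
  ... | false = refl
  ... | true with adj G x (α (3 + p)) in e₃ | adj G x (α (4 + p)) in e₄ | adj G x (α (5 + p)) in e₅
  ... | _ | false | false = ⊥-elim (noBanner bannerFree (α (2 + p)) (α (4 + p)) (α (1 + p)) (α (5 + p)) x
        (far₂ (2 + p)) (adj-sym (far₃ (1 + p))) (far₄ (1 + p)) (adj-sym (far₃ (2 + p)))
        (adj-sym (gap (1 + p))) (gap (4 + p)) e₂ e₄ h₁ e₅ (consecutive-distinct (4 + p)))
  ... | _ | false | true = ⊥-elim (noBanner bannerFree (α (5 + p)) (α p) (α (4 + p)) (α (1 + p)) x
        (adj-sym (far₅ p)) (far₄ p) (adj-sym (far₃ (1 + p))) (far₄ (1 + p))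
        (adj-sym (gap (4 + p))) (gap p) e₅ h₀ e₄ h₁ (consecutive-distinct p))
  ... | false | true | _ = ⊥-elim (noBanner bannerFree (α (4 + p)) (α p) (α (3 + p)) (α (1 + p)) x
        (adj-sym (far₄ p)) (far₃ p) (adj-sym (far₂ (1 + p))) (far₃ (1 + p))
        (adj-sym (gap (3 + p))) (gap p) e₄ h₀ e₃ h₁ (consecutive-distinct p))
  ... | true | true | _ = ⊥-elim (noBanner bannerFree (α (3 + p)) (α p) (α (2 + p)) x (α (1 + p))
        (adj-sym (far₃ p)) (far₂ p) (adj-sym e₂) e₃
        (adj-sym (gap (2 + p))) (adj-sym h₀) (far₂ (1 + p)) (adj-sym (gap p)) (gap (1 + p)) (adj-sym h₁)
        (≢-sym x≢αp))

  anticomplete-from-gap : ∀ x p → x ≢ α p → x ≢ α (1 + p) →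
    NonAdj G x (α p) → NonAdj G x (α (1 + p)) → Anticomplete x
  anticomplete-from-gap x p x≢α₀ x≢α₁ h₀ h₁ r =
    proj₁ (around (λ y → NonAdj G x y × x ≢ y) step p (h₀ , x≢α₀) (h₁ , x≢α₁) r)
    where
    step : ∀ q → NonAdj G x (α q) × x ≢ α q → NonAdj G x (α (1 + q)) × x ≢ α (1 + q) →
      NonAdj G x (α (2 + q)) × x ≢ α (2 + q)
    step q (m₀ , x≢αq) (m₁ , _) = miss-next x q x≢αq m₀ m₁ , ≢-sym (separated (far₂ q) (adj-sym m₀))

  -- A vertex outside A with a neighbour in A has two consecutive neighbours
  -- in A: otherwise its adjacencies to A would alternate around the odd
  -- cycle, or it would miss two consecutive vertices and lie in Z.
  consecutive-neighbours : ∀ x → (∀ q → x ≢ α q) → ∃[ w ] Adj G x (α w) →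
    ∃[ p ] (Adj G x (α p) × Adj G x (α (suc p)))
  consecutive-neighbours x outside (w , x~αw)
    with odd-repeat K (λ q → adj G x (α q)) (cong (adj G x) (α-period 0))
  ... | q , same with adj G x (α q) in e
  ... | true = q , e , same
  ... | false = ⊥-elim (true≢false (trans (sym x~αw)
        (anticomplete-from-gap x q (outside q) (outside (suc q)) e same w)))

  -- C₅- and banner-freeness: a vertex seeing some z ∈ Z and two consecutive
  -- vertices of A sees the next one too.  Here r = 2K + q precedes q.
  complete-step : ∀ v z → Adj G v z → Anticomplete z →
    ∀ q → Adj G v (α q) → Adj G v (α (1 + q)) → Adj G v (α (2 + q))
  complete-step v z v~z z∈Z q h₀ h₁ with adj G v (α (2 + q)) in e₂ | adj G v (α (2 * K + q)) in eᵣ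
  ... | true | _ = refl
  ... | false | false = ⊥-elim (noC5 c5Free v (α q) (α (2 + q)) (α (2 * K + q)) (α (1 + q))
        h₀ (far₂ q) (adj-sym (prev-far₃ q)) (prev-far₂ q) (adj-sym h₁)
        e₂ eᵣ (adj-sym (prev-gap q)) (gap q) (adj-sym (gap (1 + q))))
  ... | false | true = ⊥-elim (noBanner bannerFree v (α q) (α (2 + q)) (α (2 * K + q)) z
        h₀ (far₂ q) (adj-sym (prev-far₃ q)) (adj-sym eᵣ) e₂ (adj-sym (prev-gap q))
        (adj-sym v~z) (z∈Z q) (z∈Z (2 + q)) (z∈Z (2 * K + q))
        (≢-sym (separated (adj-sym (prev-far₂ q)) (adj-sym (gap q)))))

  complete-to-antihole : ∀ v z → Adj G v z → Anticomplete z →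
    ∀ p → Adj G v (α p) → Adj G v (α (suc p)) → ∀ r → Adj G v (α r)
  complete-to-antihole v z v~z z∈Z = around (Adj G v) (complete-step v z v~z z∈Z)

  misses-pair : ∀ {a b z} p → a ≡ α p → b ≡ α (suc p) → a ≢ z → b ≢ z →
    NonAdj G a z → NonAdj G b z → Anticomplete z
  misses-pair {z = z} p refl refl a≢z b≢z az bz =
    anticomplete-from-gap z p (≢-sym a≢z) (≢-sym b≢z) (adj-sym az) (adj-sym bz)

  cotriangle-anticomplete : ∀ {i j z} → CoTriangle G (A i) (A j) z → Anticomplete z
  cotriangle-anticomplete {i} {j} (i≢j , i≢z , j≢z , ij , iz , jz)
    with nonadjacent⇒consecutive i j i≢j ij
  ... | p , inj₁ (Ai≡αp , Aj≡αp+1) = misses-pair p Ai≡αp Aj≡αp+1 i≢z j≢z iz jz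
  ... | p , inj₂ (Aj≡αp , Ai≡αp+1) = misses-pair p Aj≡αp Ai≡αp+1 j≢z i≢z jz iz

  -- Membership in Z is decided on the finitely many vertices of A.
  anticomplete-A : ∀ x → (∀ i → NonAdj G x (A i)) → Anticomplete x
  anticomplete-A x misses q = misses (ι q)

  anticomplete? : ∀ x → Dec (Anticomplete x)
  anticomplete? x = map′ (anticomplete-A x) (λ x∈Z i → subst (NonAdj G x) (α-toℕ i) (x∈Z (toℕ i)))
    (all? λ i → adj G x (A i) Bool.≟ false)

  has-neighbour : ∀ x → ¬ Anticomplete x → ∃[ w ] Adj G x (α w)
  has-neighbour x x∉Z
    with ¬∀⟶∃¬ M (λ i → NonAdj G x (A i)) (λ i → adj G x (A i) Bool.≟ false) (x∉Z ∘ anticomplete-A x)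
  ... | i , x~Ai = toℕ i , subst (Adj G x) (sym (α-toℕ i)) (¬-not x~Ai)

  complete-to-A : ∀ v z → ¬ Anticomplete v → Adj G v z → Anticomplete z → ∀ r → Adj G v (α r)
  complete-to-A v z v∉Z v~z z∈Z with consecutive-neighbours v outside (has-neighbour v v∉Z)
    where
    outside : ∀ q → v ≢ α q
    outside q = separated (adj-sym v~z) (z∈Z q)
  ... | p , h₀ , h₁ = complete-to-antihole v z v~z z∈Z p h₀ h₁

  InH : Fin n → Set
  InH x = ¬ Anticomplete x × (∀ y → Anticomplete y → NonAdj G x y)

  inH? : ∀ x → Dec (InH x)
  inH? x = ¬? (anticomplete? x) ×-dec all? (λ y → anticomplete? y →-dec (adj G x y Bool.≟ false))

  H : Subset n
  H = select inH?

  H-sound : ∀ {x} → x ∈ H → InH x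
  H-sound = select-∈⁻ inH?

  Z-outside-H : ∀ {z} → Anticomplete z → z ∉ H
  Z-outside-H z∈Z z∈H = proj₁ (H-sound z∈H) z∈Z

  α-in-H : ∀ q → α q ∈ H
  α-in-H q = select-∈ inH?
    ((λ αq∈Z → true≢false (trans (sym (far₂ q)) (αq∈Z (2 + q)))) , λ y y∈Z → adj-sym (y∈Z q))

  -- A vertex v complete to A with a neighbour z ∈ Z sees every vertex h that
  -- misses z and has two consecutive neighbours aₚ, aₚ₊₁: otherwise
  -- v aₚ h aₚ₊₁ is a C₄ to which z attaches at v as a banner.
  sees-across : ∀ v z h → Adj G v z → Anticomplete z → (∀ r → Adj G v (α r)) → NonAdj G h z →
    ∃[ p ] (Adj G h (α p) × Adj G h (α (suc p))) → Adj G v h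
  sees-across v z h v~z z∈Z v-complete h≁z (p , h~αp , h~αp+1) = ¬-not λ v≁h →
    noBanner bannerFree v (α p) h (α (suc p)) z
      (v-complete p) (adj-sym h~αp) h~αp+1 (adj-sym (v-complete (suc p))) v≁h (gap p)
      (adj-sym v~z) (z∈Z p) (adj-sym h≁z) (z∈Z (suc p)) (consecutive-distinct p)

  complete-to-H : ∀ v z → Adj G v z → Anticomplete z → (∀ r → Adj G v (α r)) →
    ∀ h → h ∈ H → Adj G v h
  complete-to-H v z v~z z∈Z v-complete h h∈H = by-cases (any? λ i → h ≟ A i)
    where
    h∉Z : ¬ Anticomplete h
    h∉Z = proj₁ (H-sound h∈H)
    h≁z : NonAdj G h z
    h≁z = proj₂ (H-sound h∈H) z z∈Z
    by-cases : Dec (∃[ i ] h ≡ A i) → Adj G v h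
    by-cases (yes (i , h≡Ai)) = subst (Adj G v) (trans (α-toℕ i) (sym h≡Ai)) (v-complete (toℕ i))
    by-cases (no h∉A) = sees-across v z h v~z z∈Z v-complete h≁z
      (consecutive-neighbours h (λ q h≡αq → h∉A (ι q , h≡αq)) (has-neighbour h h∉Z))

  -- Every vertex outside H is complete or anticomplete to H: vertices of Z
  -- are anticomplete to H by definition, the others have a neighbour in Z.
  H-homogeneous : ∀ v → v ∉ H → (∀ h → h ∈ H → Adj G v h) ⊎ (∀ h → h ∈ H → NonAdj G v h)
  H-homogeneous v v∉H with anticomplete? v
  ... | yes v∈Z = inj₂ λ h h∈H → adj-sym (proj₂ (H-sound h∈H) v v∈Z)
  ... | no v∉Z with ¬∀⟶∃¬ n (λ y → Anticomplete y → NonAdj G v y)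
                     (λ y → anticomplete? y →-dec (adj G v y Bool.≟ false))
                     (λ none → v∉H (select-∈ inH? (v∉Z , none)))
  ... | z , v-sees-z with ¬→-elim (anticomplete? z) v-sees-z
  ... | z∈Z , v~z = inj₁ (complete-to-H v z (¬-not v~z) z∈Z (complete-to-A v z v∉Z (¬-not v~z) z∈Z))

  homogeneous-set : SharesCoTriangle G A → HomogeneousCover G A
  homogeneous-set (_ , _ , _ , cotriangle) = H , (size , proper , H-homogeneous) , A-in-H , no-cotriangle
    where
    size : 2 ≤ ∣ H ∣
    size = two-members (α-in-H 0) (α-in-H 1) (consecutive-distinct 0)
    proper : ∣ H ∣ < n
    proper = missing-member (Z-outside-H (cotriangle-anticomplete cotriangle))
    A-in-H : ∀ i → A i ∈ H
    A-in-H i = subst (_∈ H) (α-toℕ i) (α-in-H (toℕ i))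
    no-cotriangle : ¬ (∃[ i ] ∃[ j ] ∃[ z ] (z ∈ H × CoTriangle G (A i) (A j) z))
    no-cotriangle (_ , _ , _ , z∈H , cotriangle′) = Z-outside-H (cotriangle-anticomplete cotriangle′) z∈H

-- An antihole of length 5 is a C₅ (a₀a₂a₄a₁a₃).
antihole₅-is-C₅ : ∀ {n} (G : Graph n) → C5Free G → (A : Fin 5 → Fin n) →
  (∀ i j → adj G (A i) (A j) ≡ antiCycAdj 5 i j) → ⊥
antihole₅-is-C₅ G c5Free A antihole = GraphFacts.noC5 G c5Free (A v₀) (A v₂) (A v₄) (A v₁) (A v₃)
  (antihole v₀ v₂) (antihole v₂ v₄) (antihole v₄ v₁) (antihole v₁ v₃) (antihole v₃ v₀)
  (antihole v₀ v₄) (antihole v₀ v₁) (antihole v₂ v₁) (antihole v₂ v₃) (antihole v₄ v₃)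

lemma3 : ∀ {n m} (G : Graph n) (A : Fin m → Fin n) →
    BannerFree G → C5Free G → IsOddAntihole G A →
    (∃[ i ] ∃[ j ] ∃[ z ] CoTriangle G (A i) (A j) z) →
    ∃[ H ] (Homogeneous G H × (∀ i → A i ∈ H) ×
      ¬ (∃[ i ] ∃[ j ] ∃[ z ] (z ∈ H × CoTriangle G (A i) (A j) z)))
-- The length 2K + 1 ≥ 5 of the antihole is not 5, so it is at least 7.
lemma3 G A _ _ ((0 , refl) , s≤s () , _) _
lemma3 G A _ _ ((1 , refl) , s≤s (s≤s (s≤s ())) , _) _
lemma3 G A _ c5Free ((2 , refl) , _ , _ , antihole) _ = ⊥-elim (antihole₅-is-C₅ G c5Free A antihole)
lemma3 G A bannerFree c5Free ((K@(suc (suc (suc k))) , refl) , _ , _ , antihole) =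
  AroundOddAntihole.homogeneous-set G bannerFree c5Free K A antihole (s≤s (*-monoʳ-≤ 2 (m≤m+n 3 k)))
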